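{- Let $D$ be a diagram of a knot, $S$ a set of crossings of $D$, and $(m_1,\dots,m_\ell)$ a feasible sequence of Reidemeister moves for the pair $(D,S)$. Then $S(m_1,\dots,m_\ell)$ consists exactly of those crossings of $D(m_1,\dots,m_\ell)$ which either belong to $S$ or are not crossings of $D$.
   Context: A diagram of a knot is a piecewise linear general-position map $D\colon S^1\to\mathbb{R}^2$ with finitely many transversal double points (crossings) with over/under information; $V(D)$ is its set of crossings. An edge is an arc of $D$ between two crossings with no crossing in its interior. Reidemeister moves are of types $\mathrm{I}^-$ (removes one crossing), $\mathrm{I}^+$ (creates one crossing on an edge), $\mathrm{II}^-$ (removes two crossings), $\mathrm{II}^+$ (creates two crossings, performed on one or two edges), $\mathrm{III}$ (affects three crossings, keeping their number). Crossings are labelled and labels persist: crossings not involved in a move keep their labels, the three crossings affected by a $\mathrm{III}$ move keep their labels, and crossings created by $\mathrm{I}^+$/$\mathrm{II}^+$ moves receive fresh labels never used before (so a removed label never reappears). $D(m)$ denotes the result of a feasible move $m$, and $D(m_1,\dots,m_k):=D(m_1,\dots,m_{k-1})(m_k)$. For a set $X$ of crossings, a move avoids $X$ if it is a $\mathrm{I}^-$, $\mathrm{II}^-$ or $\mathrm{III}$ move none of whose removed/affected crossings is in $X$, or a $\mathrm{I}^+$ or $\mathrm{II}^+$ move performed on edge(s) none of whose endpoints lies in $X$. Given a set $S$ of crossings of $D$, a feasible move $m$ in $D$ is greedy with respect to $S$ if it is a $\mathrm{II}^-$ move avoiding $S$, and special with respect to $S$ if it avoids $V(D)\setminus S$. Define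 $X(m)=\emptyset$ for a $\mathrm{III}$ move, $X(m)=$ the set of removed crossings for $\mathrm{I}^-,\mathrm{II}^-$ moves, and $X(m)=$ the set of created crossings for $\mathrm{I}^+,\mathrm{II}^+$ moves. For $m$ greedy or special, $S(m):=S$ if $m$ is greedy and $S(m):=S\triangle X(m)$ ($\triangle$ = symmetric difference) if $m$ is special. A move $m$ is feasible for the pair $(D,S)$ if it is a feasible move in $D$ that is greedy or special with respect to $S$, and then $(D,S)(m):=(D(m),S(m))$; inductively $(D,S)(m_1,\dots,m_\ell):=(D,S)(m_1,\dots,m_{\ell-1})(m_\ell)$, written as $(D(m_1,\dots,m_\ell),S(m_1,\dots,m_\ell))$. A sequence $(m_1,\dots,m_\ell)$ is feasible for $(D,S)$ if each $m_i$ is feasible for $(D,S)(m_1,\dots,m_{i-1})$. -}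

module Defs where

open import Data.Nat using (ℕ)
open import Data.List using (List; []; length)
open import Data.List.Membership.Propositional using (_∈_; _∉_)
open import Data.List.Relation.Unary.Unique.Propositional using (Unique)
open import Data.Product using (_×_)
open import Data.Sum using (_⊎_)
open import Data.Empty using (⊥)
open import Relation.Nullary using (¬_)
open import Relation.Binary.PropositionalEquality using (_≡_)
open import Function.Bundles using (_⇔_)

-- Crossing labels are natural numbers; a set of crossings is a predicate on labels.
Pred : Set₁
Pred = ℕ → Set

data Kind : Set where
  I⁻ I⁺ II⁻ II⁺ III : Kind

-- Combinatorial data of a move, by type.
--  removed : crossings removed by the move
--  created : crossings created by the move
--  touched : for I⁻/II⁻/III the removed/affected crossings,
--            for I⁺/II⁺ the endpoints of the edge(s) the move is performed on
KindSpec : Kind → List ℕ → List ℕ → List ℕ → Set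
KindSpec I⁻  rem cre tch = length rem ≡ 1 × cre ≡ [] × tch ≡ rem
KindSpec II⁻ rem cre tch = length rem ≡ 2 × cre ≡ [] × tch ≡ rem
KindSpec III rem cre tch = rem ≡ [] × cre ≡ [] × length tch ≡ 3
KindSpec I⁺  rem cre tch = rem ≡ [] × length cre ≡ 1
KindSpec II⁺ rem cre tch = rem ≡ [] × length cre ≡ 2

-- Labelled knot diagrams together with their feasible Reidemeister moves,
-- axiomatised through exactly the label bookkeeping fixed in the paper.
record ReidemeisterSystem : Set₁ where
  field
    Diagram  : Set
    V        : Diagram → Pred          -- crossings of a diagram
    used     : Diagram → Pred          -- labels used so far (in the history)
    V⊆used   : ∀ D c → V D c → used D c
    Move     : Diagram → Set
    apply    : (D : Diagram) → Move D → Diagram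
    kind     : ∀ {D} → Move D → Kind
    removed  : ∀ {D} → Move D → List ℕ
    created  : ∀ {D} → Move D → List ℕ
    touched  : ∀ {D} → Move D → List ℕ
    kindSpec : ∀ {D} (m : Move D) → KindSpec (kind m) (removed m) (created m) (touched m)
    removed-unique : ∀ {D} (m : Move D) → Unique (removed m)
    created-unique : ∀ {D} (m : Move D) → Unique (created m)
    touched-V : ∀ {D} (m : Move D) c → c ∈ touched m → V D c
    -- labels persist: crossings of D(m) are the non-removed crossings of D and the created ones
    V-apply  : ∀ D (m : Move D) c →
               V (apply D m) c ⇔ ((V D c × c ∉ removed m) ⊎ c ∈ created m)
    used-mono : ∀ D (m : Move D) c → used D c → used (apply D m) c
    created-fresh : ∀ D (m : Move D) c → c ∈ created m → ¬ used D c

module _ (R : ReidemeisterSystem) where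
  open ReidemeisterSystem R

  Xm : ∀ {D} → Move D → Pred
  Xm {D} m c with kind m
  ... | I⁻  = c ∈ removed m
  ... | II⁻ = c ∈ removed m
  ... | I⁺  = c ∈ created m
  ... | II⁺ = c ∈ created m
  ... | III = ⊥

  Avoids : ∀ {D} → Move D → Pred → Set
  Avoids m X = ∀ c → c ∈ touched m → ¬ X c

  Greedy : ∀ {D} → Move D → Pred → Set
  Greedy m S = kind m ≡ II⁻ × Avoids m S

  Special : ∀ {D} → Move D → Pred → Set
  Special {D} m S = Avoids m (λ c → V D c × ¬ S c)

  _△_ : Pred → Pred → Pred
  (A △ B) c = (A c × ¬ B c) ⊎ (B c × ¬ A c)

  data PairMove (D : Diagram) (S : Pred) : Set where
    greedy  : (m : Move D) → Greedy m S → PairMove D S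
    special : (m : Move D) → Special m S → PairMove D S

  nextD : ∀ {D S} → PairMove D S → Diagram
  nextD {D} (greedy m _)  = apply D m
  nextD {D} (special m _) = apply D m

  nextS : ∀ {D S} → PairMove D S → Pred
  nextS {S = S} (greedy m _)  = S
  nextS {S = S} (special m _) = S △ Xm m

  data FeasibleSeq (D : Diagram) (S : Pred) : Set where
    []  : FeasibleSeq D S
    _∷_ : (p : PairMove D S) → FeasibleSeq (nextD p) (nextS p) → FeasibleSeq D S

  finalD : ∀ {D S} → FeasibleSeq D S → Diagram
  finalD {D} []      = D
  finalD (p ∷ σ)     = finalD σ

  finalS : ∀ {D S} → FeasibleSeq D S → Pred
  finalS {S = S} []  = S
  finalS (p ∷ σ)     = finalS σ

-- Each feasible move changes the marked set S in the same way: every move keeps the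
-- marked crossings it does not remove, a special move removes only marked crossings
-- and marks all crossings it creates, and a greedy move creates none.  So after one
-- move, S consists of the crossings that were marked before or did not exist before.
-- This one-step description composes along a sequence because a label, once gone,
-- never reappears.
module Submission where

open import Defs
open import Data.Nat using (ℕ; _≟_)
open import Data.List using ([])
open import Data.List.Membership.Propositional using (_∈_; _∉_)
open import Data.List.Membership.DecPropositional _≟_ using (_∈?_)
open import Data.Product using (_×_; _,_; proj₁; proj₂)
open import Data.Sum using (_⊎_; inj₁; inj₂; [_,_])
open import Function using (_∘_; id)
open import Function.Bundles using (_⇔_; mk⇔; Equivalence)
open import Relation.Nullary using (¬_; Dec; yes; no; contradiction)
open import Relation.Nullary.Decidable using (map′; ¬?; _×-dec_; _⊎-dec_)
open import Relation.Unary using (_⊆_)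
open import Relation.Binary.PropositionalEquality using (_≡_; refl; sym; subst)

open Equivalence

∉-when-empty : ∀ {A : Set} {x : A} {xs} → xs ≡ [] → x ∉ xs
∉-when-empty refl ()

Inherits : Pred → Pred → Pred → Pred → Set
Inherits V S V′ S′ = ∀ c → S′ c ⇔ (V′ c × (S c ⊎ ¬ V c))

Inherits-refl : ∀ {V S} → S ⊆ V → Inherits V S V S
Inherits-refl S⊆V c = mk⇔ (λ s → S⊆V s , inj₁ s) λ where
  (_ , inj₁ s)  → s
  (v , inj₂ ¬v) → contradiction v ¬v

Inherits⇒⊆ : ∀ {V S V′ S′} → Inherits V S V′ S′ → S′ ⊆ V′
Inherits⇒⊆ inh {c} = proj₁ ∘ to (inh c)

-- Deciding V₁ c is what lets the composite be read backwards constructively.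
Inherits-trans : ∀ {V S V₁ S₁ V₂ S₂} → S ⊆ V →
                 (∀ c → Dec (V c) → Dec (V₁ c)) →
                 (∀ c → V c → ¬ V₁ c → ¬ V₂ c) →
                 Inherits V S V₁ S₁ → Inherits V₁ S₁ V₂ S₂ → Inherits V S V₂ S₂
Inherits-trans {V} {S} {V₁} {S₁} {V₂} {S₂} S⊆V dec gone h₀₁ h₁₂ c = mk⇔ forward backward
  where
  forward : S₂ c → V₂ c × (S c ⊎ ¬ V c)
  forward s₂ with to (h₁₂ c) s₂
  ... | v₂ , inj₁ s₁  = v₂ , proj₂ (to (h₀₁ c) s₁)
  ... | v₂ , inj₂ ¬v₁ = v₂ , inj₂ λ v → gone c v ¬v₁ v₂

  backward : V₂ c × (S c ⊎ ¬ V c) → S₂ c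
  backward (v₂ , old) with dec c ([ yes ∘ S⊆V , no ] old)
  ... | yes v₁ = from (h₁₂ c) (v₂ , inj₁ (from (h₀₁ c) (v₁ , old)))
  ... | no ¬v₁ = from (h₁₂ c) (v₂ , inj₂ ¬v₁)

module Moves (R : ReidemeisterSystem) where
  open ReidemeisterSystem R

  module _ {S X : Pred} where

    △-of-marked : (∀ {c} → X c → ¬ ¬ S c) → ∀ c → _△_ R S X c ⇔ (S c × ¬ X c)
    △-of-marked X⊆S c = mk⇔ [ id , (λ (x , ¬s) → contradiction ¬s (X⊆S x)) ] inj₁

    △-of-unmarked : (∀ {c} → X c → ¬ S c) → ∀ c → _△_ R S X c ⇔ (S c ⊎ X c)
    △-of-unmarked X∩S=∅ c = mk⇔ [ inj₁ ∘ proj₁ , inj₂ ∘ proj₁ ] λ where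
      (inj₁ s) → inj₁ (s , λ x → X∩S=∅ x s)
      (inj₂ x) → inj₂ (x , X∩S=∅ x)

  module _ {D : Diagram} (m : Move D) where

    V-apply-kept : ∀ {c} → V D c → c ∉ removed m → V (apply D m) c
    V-apply-kept v ∉rem = from (V-apply D m _) (inj₁ (v , ∉rem))

    V-apply-created : ∀ {c} → c ∈ created m → V (apply D m) c
    V-apply-created ∈cre = from (V-apply D m _) (inj₂ ∈cre)

    V-apply-dec : ∀ c → Dec (V D c) → Dec (V (apply D m) c)
    V-apply-dec c v? = map′ (from (V-apply D m c)) (to (V-apply D m c))
                            ((v? ×-dec ¬? (c ∈? removed m)) ⊎-dec (c ∈? created m))

    absent-stays-absent : ∀ {c} → used D c → ¬ V D c → ¬ V (apply D m) c
    absent-stays-absent u ¬v v′ =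
      [ ¬v ∘ proj₁ , (λ ∈cre → created-fresh D m _ ∈cre u) ] (to (V-apply D m _) v′)

    created-∉V : ∀ {c} → c ∈ created m → ¬ V D c
    created-∉V ∈cre = created-fresh D m _ ∈cre ∘ V⊆used D _

  module _ {D : Diagram} {S : Pred} (S⊆V : S ⊆ V D) where

    deletion-inherits : (m : Move D) {S′ : Pred} → created m ≡ [] →
                        (∀ c → S′ c ⇔ (S c × c ∉ removed m)) →
                        Inherits (V D) S (V (apply D m)) S′
    deletion-inherits m {S′} no-cre S′⇔ c = mk⇔ forward backward
      where
      forward : S′ c → V (apply D m) c × (S c ⊎ ¬ V D c)
      forward s′ with to (S′⇔ c) s′
      ... | s , ∉rem = V-apply-kept m (S⊆V s) ∉rem , inj₁ s

      backward : V (apply D m) c × (S c ⊎ ¬ V D c) → S′ c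
      backward (v′ , old) with to (V-apply D m c) v′
      ... | inj₁ (v , ∉rem) = from (S′⇔ c) ([ id , contradiction v ] old , ∉rem)
      ... | inj₂ ∈cre       = contradiction ∈cre (∉-when-empty no-cre)

    insertion-inherits : (m : Move D) {S′ : Pred} → removed m ≡ [] →
                         (∀ c → S′ c ⇔ (S c ⊎ c ∈ created m)) →
                         Inherits (V D) S (V (apply D m)) S′
    insertion-inherits m {S′} no-rem S′⇔ c = mk⇔ forward backward
      where
      forward : S′ c → V (apply D m) c × (S c ⊎ ¬ V D c)
      forward s′ with to (S′⇔ c) s′
      ... | inj₁ s    = V-apply-kept m (S⊆V s) (∉-when-empty no-rem) , inj₁ s
      ... | inj₂ ∈cre = V-apply-created m ∈cre , inj₂ (created-∉V m ∈cre)

      backward : V (apply D m) c × (S c ⊎ ¬ V D c) → S′ c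
      backward (_  , inj₁ s)  = from (S′⇔ c) (inj₁ s)
      backward (v′ , inj₂ ¬v) = from (S′⇔ c) (inj₂ (new-is-created (to (V-apply D m c) v′)))
        where
        new-is-created : (V D c × c ∉ removed m) ⊎ c ∈ created m → c ∈ created m
        new-is-created = [ (λ (v , _) → contradiction v ¬v) , id ]

    greedy-inherits : (m : Move D) → Greedy R m S → Inherits (V D) S (V (apply D m)) S
    greedy-inherits m (is-II⁻ , avoids-S) with kind m | kindSpec m | is-II⁻
    ... | .II⁻ | _ , no-cre , tch≡rem | refl = deletion-inherits m no-cre λ c →
      mk⇔ (λ s → s , λ ∈rem → avoids-S c (subst (c ∈_) (sym tch≡rem) ∈rem) s) proj₁

    removed-marked : (m : Move D) → Special R m S → touched m ≡ removed m →
                     ∀ {c} → c ∈ removed m → ¬ ¬ S c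
    removed-marked m sp tch≡rem {c} ∈rem ¬s = sp c ∈tch (touched-V m c ∈tch , ¬s)
      where ∈tch = subst (c ∈_) (sym tch≡rem) ∈rem

    created-unmarked : (m : Move D) → ∀ {c} → c ∈ created m → ¬ S c
    created-unmarked m ∈cre = created-∉V m ∈cre ∘ S⊆V

    special-inherits : (m : Move D) → Special R m S →
                       Inherits (V D) S (V (apply D m)) (_△_ R S (Xm R m))
    special-inherits m sp with kind m | kindSpec m
    ... | I⁻  | _ , no-cre , tch≡rem =
      deletion-inherits m no-cre (△-of-marked (removed-marked m sp tch≡rem))
    ... | II⁻ | _ , no-cre , tch≡rem =
      deletion-inherits m no-cre (△-of-marked (removed-marked m sp tch≡rem))
    ... | I⁺  | no-rem , _ = insertion-inherits m no-rem (△-of-unmarked (created-unmarked m))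
    ... | II⁺ | no-rem , _ = insertion-inherits m no-rem (△-of-unmarked (created-unmarked m))
    ... | III | no-rem , no-cre , _ = deletion-inherits m no-cre λ c →
      mk⇔ (λ { (inj₁ (s , _)) → s , ∉-when-empty no-rem ; (inj₂ (() , _)) })
          (λ (s , _) → inj₁ (s , λ ()))

    pairMove-inherits : (p : PairMove R D S) → Inherits (V D) S (V (nextD R p)) (nextS R p)
    pairMove-inherits (greedy m g)   = greedy-inherits m g
    pairMove-inherits (special m sp) = special-inherits m sp

  for-underlying-move : ∀ {D S} {P : Diagram → Set} →
                        (∀ m → P (apply D m)) → (p : PairMove R D S) → P (nextD R p)
  for-underlying-move f (greedy m _)  = f m
  for-underlying-move f (special m _) = f m

  module _ {D S} (p : PairMove R D S) {c : ℕ} where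

    used-next : used D c → used (nextD R p) c
    used-next u = for-underlying-move {P = λ D′ → used D′ c} (λ m → used-mono D m c u) p

    absent-next : used D c → ¬ V D c → ¬ V (nextD R p) c
    absent-next u ¬v =
      for-underlying-move {P = λ D′ → ¬ V D′ c} (λ m → absent-stays-absent m u ¬v) p

    V-next-dec : Dec (V D c) → Dec (V (nextD R p) c)
    V-next-dec v? = for-underlying-move {P = λ D′ → Dec (V D′ c)} (λ m → V-apply-dec m c v?) p

  absent-stays-absent* : ∀ {D S c} (σ : FeasibleSeq R D S) →
                         used D c → ¬ V D c → ¬ V (finalD R σ) c
  absent-stays-absent* []      u ¬v = ¬v
  absent-stays-absent* (p ∷ σ) u ¬v = absent-stays-absent* σ (used-next p u) (absent-next p u ¬v)

  feasibleSeq-inherits : ∀ {D S} → S ⊆ V D → (σ : FeasibleSeq R D S) →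
                         Inherits (V D) S (V (finalD R σ)) (finalS R σ)
  feasibleSeq-inherits S⊆V []      = Inherits-refl S⊆V
  feasibleSeq-inherits {D} S⊆V (p ∷ σ) = Inherits-trans S⊆V
    (λ _ → V-next-dec p)
    (λ c v → absent-stays-absent* σ (used-next p (V⊆used D c v)))
    step
    (feasibleSeq-inherits (Inherits⇒⊆ step) σ)
    where step = pairMove-inherits S⊆V p

lemma7 : (R : ReidemeisterSystem) → let open ReidemeisterSystem R in
         (D : Diagram) (S : Pred) → (∀ c → S c → V D c) →
         (σ : FeasibleSeq R D S) →
         ∀ c → finalS R σ c ⇔ (V (finalD R σ) c × (S c ⊎ ¬ V D c))
lemma7 R D S S⊆V = Moves.feasibleSeq-inherits R (S⊆V _)
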